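{- In the setting below, assume $\hat H$ satisfies (S1) and (S2). Let $f_i\colon(A_i,\alpha_i)\to(B_i,\beta_i)$ be pathwise-embeddings in $\mathrm{EM}(\mathbb{C}_i)$ for $i=1,\dots,n$, and let $e\colon(P,\pi)\to\hat H((A_i,\alpha_i)_i)$ and $g\colon(P,\pi)\to\hat H((B_i,\beta_i)_i)$ be path embeddings with $\hat H(f_1,\dots,f_n)\circ e=g$. Let $e=\hat H(e_1,\dots,e_n)\circ e_0$ and $g=\hat H(g_1,\dots,g_n)\circ g_0$ be the minimal decompositions given by (S2), with path embeddings $e_i\colon(P_i,\pi_i)\to(A_i,\alpha_i)$ and $g_i\colon(Q_i,\rho_i)\to(B_i,\beta_i)$. Then for each $i$ there exists a coalgebra morphism $f'_i\colon(P_i,\pi_i)\to(Q_i,\rho_i)$ with $f_i\circ e_i=g_i\circ f'_i$.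
   Context: Setting: each of $\mathcal{C}_1,\dots,\mathcal{C}_n,\mathcal{D}$ is a category of $\sigma$-structures or pointed $\sigma$-structures with homomorphisms; $\mathbb{C}_i$ are comonads on $\mathcal{C}_i$, $\mathbb{D}$ a comonad on $\mathcal{D}$ preserving embeddings (embedding = injective homomorphism reflecting relations); $H\colon\prod_i\mathcal{C}_i\to\mathcal{D}$ is a functor with a Kleisli law $\kappa\colon\mathbb{D}\circ H\Rightarrow H\circ\prod_i\mathbb{C}_i$, and $\hat H\colon\prod_i\mathrm{EM}(\mathbb{C}_i)\to\mathrm{EM}(\mathbb{D})$ is its lifting to Eilenberg–Moore coalgebra categories. In each $\mathrm{EM}$ category a class of coalgebras called paths is fixed. A coalgebra morphism is an embedding if its underlying homomorphism is; a path embedding is an embedding whose domain is a path. A coalgebra morphism $f\colon X\to Y$ is a pathwise-embedding if $f\circ e$ is an embedding for every path embedding $e\colon P\to X$. (S1): $\hat H$ sends tuples of embeddings to embeddings. (S2): every path embedding $e\colon P\to\hat H(X_1,\dots,X_n)$ has a minimal decomposition $e=\hat H(e_1,\dots,e_n)\circ e_0$ with $e_0\colon P\to\hat H(P_1,\dots,P_n)$ and path embeddings $e_i\colon P_i\to X_i$, minimal meaning: for every decomposition $e=\hat H(g_1,\dots,g_n)\circ g_0$ with path embeddings $g_i\colon Q_i\to X_i$ there are (necessarily unique) coalgebra morphisms $h_i\colon P_i\to Q_i$ with $e_i=g_i\circ h_i$. -}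

module Defs where

open import Data.Nat using (ℕ)
open import Data.Fin using (Fin)
open import Data.Vec using (Vec; map)
open import Data.Product using (Σ; _×_; _,_)
open import Relation.Binary.PropositionalEquality using (_≡_)

record Signature : Set₁ where
  field
    Rel   : Set
    arity : Rel → ℕ
open Signature public

record Structure (σ : Signature) : Set₁ where
  field
    Carrier : Set
    rel     : (R : Rel σ) → Vec Carrier (arity σ R) → Set
open Structure public

record Homomorphism {σ : Signature} (A B : Structure σ) : Set where
  field
    fun  : Carrier A → Carrier B
    pres : ∀ R (xs : Vec (Carrier A) (arity σ R)) → rel A R xs → rel B R (map fun xs)
open Homomorphism public

IsEmbedding : {σ : Signature} {A B : Structure σ} → Homomorphism A B → Set
IsEmbedding {σ} {A} {B} h =
  (∀ x y → fun h x ≡ fun h y → x ≡ y) ×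
  (∀ R (xs : Vec (Carrier A) (arity σ R)) → rel B R (map (fun h) xs) → rel A R xs)

-- An Eilenberg–Moore category of coalgebras, presented concretely over
-- σ-structures: objects are coalgebras, morphisms are coalgebra
-- morphisms, and U sends them to their underlying structure /
-- homomorphism.

record EMCat (σ : Signature) : Set₂ where
  field
    Obj    : Set₁
    Hom    : Obj → Obj → Set
    U₀     : Obj → Structure σ
    U₁     : ∀ {X Y} → Hom X Y → Homomorphism (U₀ X) (U₀ Y)
    idᶜ    : ∀ X → Hom X X
    _∘ᶜ_   : ∀ {X Y Z} → Hom Y Z → Hom X Y → Hom X Z
    U-id   : ∀ X x → fun (U₁ (idᶜ X)) x ≡ x
    U-∘    : ∀ {X Y Z} (g : Hom Y Z) (f : Hom X Y) x →
             fun (U₁ (g ∘ᶜ f)) x ≡ fun (U₁ g) (fun (U₁ f) x)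
    IsPath : Obj → Set
open EMCat public

module _ {σ : Signature} (C : EMCat σ) where

  Eq : ∀ {X Y} → Hom C X Y → Hom C X Y → Set
  Eq f g = ∀ x → fun (U₁ C f) x ≡ fun (U₁ C g) x

  IsEmb : ∀ {X Y} → Hom C X Y → Set
  IsEmb f = IsEmbedding (U₁ C f)

  IsPathEmb : ∀ {P X} → Hom C P X → Set
  IsPathEmb {P} e = IsPath C P × IsEmb e

  IsPathwiseEmb : ∀ {X Y} → Hom C X Y → Set₁
  IsPathwiseEmb {X} f = ∀ {P} (e : Hom C P X) → IsPathEmb e → IsEmb (_∘ᶜ_ C f e)

module _ {n : ℕ} {σs : Fin n → Signature} (Cs : (i : Fin n) → EMCat (σs i))
         {τ : Signature} (D : EMCat τ) where

  Objs : Set₁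
  Objs = (i : Fin n) → Obj (Cs i)

  Homs : Objs → Objs → Set
  Homs X Y = (i : Fin n) → Hom (Cs i) (X i) (Y i)

  record LiftedFunctor : Set₁ where
    field
      F₀     : Objs → Obj D
      F₁     : ∀ {X Y} → Homs X Y → Hom D (F₀ X) (F₀ Y)
      F-id   : ∀ X → Eq D (F₁ (λ i → idᶜ (Cs i) (X i))) (idᶜ D (F₀ X))
      F-∘    : ∀ {X Y Z} (g : Homs Y Z) (f : Homs X Y) →
               Eq D (F₁ (λ i → _∘ᶜ_ (Cs i) (g i) (f i))) (_∘ᶜ_ D (F₁ g) (F₁ f))
      F-resp : ∀ {X Y} (f g : Homs X Y) → (∀ i → Eq (Cs i) (f i) (g i)) →
               Eq D (F₁ f) (F₁ g)
  open LiftedFunctor public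

  module _ (Ĥ : LiftedFunctor) where

    S1 : Set₁
    S1 = ∀ {X Y} (f : Homs X Y) → (∀ i → IsEmb (Cs i) (f i)) → IsEmb D (F₁ Ĥ f)

    record Decomposition {P : Obj D} {X : Objs} (e : Hom D P (F₀ Ĥ X)) : Set₁ where
      field
        Ps     : Objs
        e₀     : Hom D P (F₀ Ĥ Ps)
        es     : Homs Ps X
        es-pe  : ∀ i → IsPathEmb (Cs i) (es i)
        factor : Eq D e (_∘ᶜ_ D (F₁ Ĥ es) e₀)
    open Decomposition public

    IsMinimal : {P : Obj D} {X : Objs} {e : Hom D P (F₀ Ĥ X)} → Decomposition e → Set₁
    IsMinimal {e = e} d = (d' : Decomposition e) → ∀ i →
      Σ (Hom (Cs i) (Ps d i) (Ps d' i)) λ h →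
        Eq (Cs i) (es d i) (_∘ᶜ_ (Cs i) (es d' i) h)

    S2 : Set₁
    S2 = ∀ {P : Obj D} {X : Objs} (e : Hom D P (F₀ Ĥ X)) → IsPathEmb D e →
         Σ (Decomposition e) IsMinimal

-- Postcomposing the decomposition of e with the pathwise-embeddings fᵢ gives a
-- decomposition of g through the embeddings fᵢ ∘ eᵢ, so minimality of the
-- decomposition of g yields hᵢ : Qᵢ → Pᵢ with gᵢ = fᵢ ∘ eᵢ ∘ hᵢ.  Since Ĥ(fᵢ ∘ eᵢ)
-- is an embedding by (S1), hence monic, the two first legs are related by
-- e₀ = Ĥ(h) ∘ g₀, so e also decomposes as Ĥ(eᵢ ∘ hᵢ) ∘ g₀; the eᵢ ∘ hᵢ are
-- embeddings because fᵢ ∘ (eᵢ ∘ hᵢ) = gᵢ is one.  Minimality of the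
-- decomposition of e now gives f′ᵢ with eᵢ = eᵢ ∘ hᵢ ∘ f′ᵢ, and then
-- fᵢ ∘ eᵢ = gᵢ ∘ f′ᵢ.
module Submission where

open import Defs
open import Data.Nat using (ℕ)
open import Data.Fin using (Fin)
open import Data.Product using (Σ; _,_; proj₁; proj₂)
open import Data.Vec using (Vec; map)
open import Data.Vec.Properties using (map-∘; map-cong)
open import Function using (_∘_)
open import Level using (0ℓ)
open import Relation.Binary.Bundles using (Setoid)
open import Relation.Binary.PropositionalEquality
  using (_≡_; _≗_; refl; sym; trans; cong; subst)
import Relation.Binary.Reasoning.Setoid as SetoidReasoning

isEmbedding-factorʳ : ∀ {σ} {A B C : Structure σ}
  (k : Homomorphism A B) (m : Homomorphism B C) (g : Homomorphism A C) →
  fun g ≗ fun m ∘ fun k → IsEmbedding g → IsEmbedding k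
isEmbedding-factorʳ {A = A} {C = C} k m g g≗mk (g-inj , g-refl) =
  (λ x y kx≡ky → g-inj x y (trans (g≗mk x) (trans (cong (fun m) kx≡ky) (sym (g≗mk y))))) ,
  λ R xs r → g-refl R xs (subst (rel C R) (mk≡g xs) (pres m R _ r))
  where
  mk≡g : ∀ {l} (xs : Vec (Carrier A) l) → map (fun m) (map (fun k) xs) ≡ map (fun g) xs
  mk≡g xs = trans (sym (map-∘ (fun m) (fun k) xs)) (map-cong (sym ∘ g≗mk) xs)

module HomReasoning {σ : Signature} (C : EMCat σ) where

  infix  4 _≈_
  infixr 9 _∙_

  _≈_ : ∀ {X Y} → Hom C X Y → Hom C X Y → Set
  _≈_ = Eq C

  _∙_ : ∀ {X Y Z} → Hom C Y Z → Hom C X Y → Hom C X Z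
  _∙_ = _∘ᶜ_ C

  homSetoid : Obj C → Obj C → Setoid 0ℓ 0ℓ
  homSetoid X Y = record
    { Carrier       = Hom C X Y
    ; _≈_           = _≈_
    ; isEquivalence = record
      { refl  = λ _ → refl
      ; sym   = λ p x → sym (p x)
      ; trans = λ p q x → trans (p x) (q x)
      }
    }

  open module Reasoning {X} {Y} = SetoidReasoning (homSetoid X Y) public

  ∙-assoc : ∀ {W X Y Z} (h : Hom C Y Z) (g : Hom C X Y) (f : Hom C W X) →
            (h ∙ g) ∙ f ≈ h ∙ (g ∙ f)
  ∙-assoc h g f x = trans (U-∘ C (h ∙ g) f x)
    (trans (U-∘ C h g _) (sym (trans (U-∘ C h (g ∙ f) x) (cong (fun (U₁ C h)) (U-∘ C g f x)))))

  ∙-congˡ : ∀ {X Y Z} (g : Hom C Y Z) {f f′ : Hom C X Y} → f ≈ f′ → g ∙ f ≈ g ∙ f′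
  ∙-congˡ g {f} {f′} p x =
    trans (U-∘ C g f x) (trans (cong (fun (U₁ C g)) (p x)) (sym (U-∘ C g f′ x)))

  ∙-congʳ : ∀ {X Y Z} {g g′ : Hom C Y Z} (f : Hom C X Y) → g ≈ g′ → g ∙ f ≈ g′ ∙ f
  ∙-congʳ {g = g} {g′} f p x =
    trans (U-∘ C g f x) (trans (p _) (sym (U-∘ C g′ f x)))

  isEmb-factorʳ : ∀ {X Y Z} {g : Hom C X Z} (m : Hom C Y Z) (k : Hom C X Y) →
                  g ≈ m ∙ k → IsEmb C g → IsEmb C k
  isEmb-factorʳ {g = g} m k g≈mk =
    isEmbedding-factorʳ (U₁ C k) (U₁ C m) (U₁ C g) (λ x → trans (g≈mk x) (U-∘ C m k x))

  isEmb-cancelˡ : ∀ {X Y Z} {m : Hom C Y Z} {f f′ : Hom C X Y} →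
                  IsEmb C m → m ∙ f ≈ m ∙ f′ → f ≈ f′
  isEmb-cancelˡ {m = m} {f} {f′} (m-inj , _) p x =
    m-inj _ _ (trans (sym (U-∘ C m f x)) (trans (p x) (U-∘ C m f′ x)))

module Decompositions {n : ℕ} {σs : Fin n → Signature} (Cs : (i : Fin n) → EMCat (σs i))
                      {τ : Signature} (D : EMCat τ) (Ĥ : LiftedFunctor Cs D) where

  open HomReasoning D

  infix  4 _≈ᵢ_
  infixr 9 _∙ᵢ_

  _≈ᵢ_ : ∀ {X Y} → Homs Cs D X Y → Homs Cs D X Y → Set
  f ≈ᵢ g = ∀ i → Eq (Cs i) (f i) (g i)

  _∙ᵢ_ : ∀ {X Y Z} → Homs Cs D Y Z → Homs Cs D X Y → Homs Cs D X Z
  (g ∙ᵢ f) i = _∘ᶜ_ (Cs i) (g i) (f i)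

  module _ {P : Obj D} {A : Objs Cs D} {e : Hom D P (F₀ Ĥ A)} where

    postcompose : ∀ {B} {g : Hom D P (F₀ Ĥ B)} (f : Homs Cs D A B) →
                  (∀ i → IsPathwiseEmb (Cs i) (f i)) → F₁ Ĥ f ∙ e ≈ g →
                  Decomposition Cs D Ĥ e → Decomposition Cs D Ĥ g
    postcompose {g = g} f f-pw fe≈g d = record
      { Ps     = Ps d
      ; e₀     = e₀ d
      ; es     = f ∙ᵢ es d
      ; es-pe  = λ i → proj₁ (es-pe d i) , f-pw i (es d i) (es-pe d i)
      ; factor = begin
          g                               ≈⟨ fe≈g ⟨
          F₁ Ĥ f ∙ e                      ≈⟨ ∙-congˡ (F₁ Ĥ f) (factor d) ⟩
          F₁ Ĥ f ∙ (F₁ Ĥ (es d) ∙ e₀ d)   ≈⟨ ∙-assoc (F₁ Ĥ f) (F₁ Ĥ (es d)) (e₀ d) ⟨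
          (F₁ Ĥ f ∙ F₁ Ĥ (es d)) ∙ e₀ d   ≈⟨ ∙-congʳ (e₀ d) (F-∘ Ĥ f (es d)) ⟨
          F₁ Ĥ (f ∙ᵢ es d) ∙ e₀ d         ∎
      }

    factorThrough : (d : Decomposition Cs D Ĥ e) {Qs : Objs Cs D}
                    (h : Homs Cs D Qs (Ps d)) (q₀ : Hom D P (F₀ Ĥ Qs)) →
                    e₀ d ≈ F₁ Ĥ h ∙ q₀ → (∀ i → IsPathEmb (Cs i) ((es d ∙ᵢ h) i)) →
                    Decomposition Cs D Ĥ e
    factorThrough d {Qs} h q₀ e₀≈hq₀ eh-pe = record
      { Ps     = Qs
      ; e₀     = q₀
      ; es     = es d ∙ᵢ h
      ; es-pe  = eh-pe
      ; factor = begin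
          e                               ≈⟨ factor d ⟩
          F₁ Ĥ (es d) ∙ e₀ d              ≈⟨ ∙-congˡ (F₁ Ĥ (es d)) e₀≈hq₀ ⟩
          F₁ Ĥ (es d) ∙ (F₁ Ĥ h ∙ q₀)     ≈⟨ ∙-assoc (F₁ Ĥ (es d)) (F₁ Ĥ h) q₀ ⟨
          (F₁ Ĥ (es d) ∙ F₁ Ĥ h) ∙ q₀     ≈⟨ ∙-congʳ q₀ (F-∘ Ĥ (es d) h) ⟨
          F₁ Ĥ (es d ∙ᵢ h) ∙ q₀           ∎
      }

    e₀-comparison : S1 Cs D Ĥ → (d₁ d₂ : Decomposition Cs D Ĥ e) (h : Homs Cs D (Ps d₂) (Ps d₁)) →
                    es d₂ ≈ᵢ es d₁ ∙ᵢ h →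
                    e₀ d₁ ≈ F₁ Ĥ h ∙ e₀ d₂
    e₀-comparison s1 d₁ d₂ h es₂≈es₁h =
      isEmb-cancelˡ (s1 (es d₁) (λ i → proj₂ (es-pe d₁ i))) (begin
        F₁ Ĥ (es d₁) ∙ e₀ d₁              ≈⟨ factor d₁ ⟨
        e                                 ≈⟨ factor d₂ ⟩
        F₁ Ĥ (es d₂) ∙ e₀ d₂              ≈⟨ ∙-congʳ (e₀ d₂) (F-resp Ĥ (es d₂) (es d₁ ∙ᵢ h) es₂≈es₁h) ⟩
        F₁ Ĥ (es d₁ ∙ᵢ h) ∙ e₀ d₂         ≈⟨ ∙-congʳ (e₀ d₂) (F-∘ Ĥ (es d₁) h) ⟩
        (F₁ Ĥ (es d₁) ∙ F₁ Ĥ h) ∙ e₀ d₂   ≈⟨ ∙-assoc (F₁ Ĥ (es d₁)) (F₁ Ĥ h) (e₀ d₂) ⟩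
        F₁ Ĥ (es d₁) ∙ (F₁ Ĥ h ∙ e₀ d₂)   ∎)

lemma4 : {n : ℕ} {σs : Fin n → Signature} (Cs : (i : Fin n) → EMCat (σs i))
         {τ : Signature} (D : EMCat τ) (Ĥ : LiftedFunctor Cs D) →
         S1 Cs D Ĥ → S2 Cs D Ĥ →
         (A B : Objs Cs D) (f : Homs Cs D A B) →
         (∀ i → IsPathwiseEmb (Cs i) (f i)) →
         (P : Obj D) (e : Hom D P (F₀ Ĥ A)) (g : Hom D P (F₀ Ĥ B)) →
         IsPathEmb D e → IsPathEmb D g →
         Eq D (_∘ᶜ_ D (F₁ Ĥ f) e) g →
         (de : Decomposition Cs D Ĥ e) → IsMinimal Cs D Ĥ de →
         (dg : Decomposition Cs D Ĥ g) → IsMinimal Cs D Ĥ dg →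
         (i : Fin n) →
         Σ (Hom (Cs i) (Ps de i) (Ps dg i)) λ f′ →
           Eq (Cs i) (_∘ᶜ_ (Cs i) (f i) (es de i)) (_∘ᶜ_ (Cs i) (es dg i) f′)
lemma4 Cs D Ĥ s1 _ _ _ f f-pw _ e g _ _ fe≈g de de-min dg dg-min i = f′ i , fe≈gf′ i
  where
  open Decompositions Cs D Ĥ

  dg′ : Decomposition Cs D Ĥ g
  dg′ = postcompose f f-pw fe≈g de

  h : Homs Cs D (Ps dg) (Ps de)
  h j = proj₁ (dg-min dg′ j)

  es-dg≈feh : es dg ≈ᵢ (f ∙ᵢ es de) ∙ᵢ h
  es-dg≈feh j = proj₂ (dg-min dg′ j)

  eh-isPathEmb : ∀ j → IsPathEmb (Cs j) ((es de ∙ᵢ h) j)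
  eh-isPathEmb j = proj₁ (es-pe dg j) ,
    isEmb-factorʳ (f j) (es de j ∙ h j)
      (λ x → trans (es-dg≈feh j x) (∙-assoc (f j) (es de j) (h j) x))
      (proj₂ (es-pe dg j))
    where open HomReasoning (Cs j)

  de′ : Decomposition Cs D Ĥ e
  de′ = factorThrough de h (e₀ dg) (e₀-comparison s1 dg′ dg h es-dg≈feh) eh-isPathEmb

  f′ : Homs Cs D (Ps de) (Ps dg)
  f′ j = proj₁ (de-min de′ j)

  fe≈gf′ : f ∙ᵢ es de ≈ᵢ es dg ∙ᵢ f′
  fe≈gf′ j = begin
    f j ∙ es de j                       ≈⟨ ∙-congˡ (f j) (proj₂ (de-min de′ j)) ⟩
    f j ∙ ((es de j ∙ h j) ∙ f′ j)      ≈⟨ ∙-congˡ (f j) (∙-assoc (es de j) (h j) (f′ j)) ⟩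
    f j ∙ (es de j ∙ (h j ∙ f′ j))      ≈⟨ ∙-assoc (f j) (es de j) (h j ∙ f′ j) ⟨
    (f j ∙ es de j) ∙ (h j ∙ f′ j)      ≈⟨ ∙-assoc (f j ∙ es de j) (h j) (f′ j) ⟨
    ((f j ∙ es de j) ∙ h j) ∙ f′ j      ≈⟨ ∙-congʳ (f′ j) (es-dg≈feh j) ⟨
    es dg j ∙ f′ j                      ∎
    where open HomReasoning (Cs j)
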